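{- The axiomatization $\mathbf{SML}$ is complete for $\mathcal{L}^{\Box\rightrightarrows}$: every valid formula of $\mathcal{L}^{\Box\rightrightarrows}$ is derivable in $\mathbf{SML}$.
   Context: Fix a non-empty countable set $P$ of atoms and a non-empty finite set $A$ of agents. $\mathcal{L}^{\Box\rightrightarrows}$: $\varphi ::= p \mid \neg\varphi \mid (\varphi\wedge\varphi) \mid \Box_a\varphi \mid [\rightrightarrows]\varphi$; $\mathcal{L}^\Box$ is the fragment without $[\rightrightarrows]$, $\mathcal{L}_0$ the propositional fragment. Abbreviations: Boolean connectives, $\Diamond_a\varphi:=\neg\Box_a\neg\varphi$, $\langle\rightrightarrows\rangle\varphi:=\neg[\rightrightarrows]\neg\varphi$, $\nabla_a\Phi:=\bigwedge_{\varphi\in\Phi}\Diamond_a\varphi\wedge\Box_a\bigvee_{\varphi\in\Phi}\varphi$ for finite $\Phi$. A model is $M=(S,R,V)$ with $S$ non-empty countable, $R_a\subseteq S\times S$, $V:S\to\mathcal{P}(P)$. For models $M,M'$, a non-empty $Z\subseteq S\times S'$ is a simulation if for all $(s,s')\in Z$, $a\in A$: $V(s)=V'(s')$, and if $(s,t)\in R_a$ then there is $t'$ with $(s',t')\in R'_a$ and $(t,t')\in Z$. $M_s\rightrightarrows M'_{s'}$: some simulation contains $(s,s')$. Semantics: $M_s\models p$ iff $p\in V(s)$; Boolean clauses as usual; $M_s\models\Box_a\varphi$ iff $M_t\models\varphi$ for all $(s,t)\in R_a$; $M_s\models[\rightrightarrows]\varphi$ iff $M'_{s'}\models\varphi$ for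 all $M'_{s'}$ with $M_s\rightrightarrows M'_{s'}$. Valid: true at every pointed model. $\mathbf{SML}$ over $\mathcal{L}^{\Box\rightrightarrows}$: Prop; K: $\Box_a(\varphi\to\psi)\to(\Box_a\varphi\to\Box_a\psi)$; MP; N: from $\varphi$ infer $\Box_a\varphi$; RE: from $\chi\leftrightarrow\psi$ infer $\varphi[\chi/p]\leftrightarrow\varphi[\psi/p]$; SQ1: $\langle\rightrightarrows\rangle\varphi_0\leftrightarrow\varphi_0$ ($\varphi_0\in\mathcal{L}_0$); SQ2: $\langle\rightrightarrows\rangle(\varphi\vee\psi)\leftrightarrow(\langle\rightrightarrows\rangle\varphi\vee\langle\rightrightarrows\rangle\psi)$; SQ3: $\langle\rightrightarrows\rangle(\varphi_0\wedge\varphi)\leftrightarrow(\varphi_0\wedge\langle\rightrightarrows\rangle\varphi)$ ($\varphi_0\in\mathcal{L}_0$); SQ4$_{\mathsf{cons}}$: $\langle\rightrightarrows\rangle\bigwedge_{a\in A}\nabla_a\Phi_a\leftrightarrow\bigwedge_{a\in A}\Box_a\bigvee_{\varphi\in\Phi_a}\langle\rightrightarrows\rangle\varphi$, for finite sets $\Phi_a$ all of whose elements are consistent $\mathcal{L}^\Box$ formulas (consistent in basic multi-modal logic K, i.e. satisfiable). -}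

module Defs where

open import Level using (Lift)
open import Data.Nat using (ℕ)
import Data.Nat as ℕ
import Data.Nat.Properties as ℕP
open import Data.Fin using (Fin)
open import Data.Bool using (Bool; true; false; not; if_then_else_) renaming (_∧_ to _&&_)
open import Data.List using (List; []; _∷_; map; allFin)
open import Data.List.Membership.Propositional using (_∈_)
open import Data.Product using (Σ; _×_; _,_)
open import Relation.Binary.PropositionalEquality using (_≡_; refl; cong)
open import Relation.Nullary using (¬_; Dec; yes; no)
open import Function.Definitions using (Injective)

record Atoms : Set₁ where
  field
    Atom : Set
    atomCode : Atom → ℕ
    atomCode-injective : Injective _≡_ _≡_ atomCode
    atom₀ : Atom

module Logic (AT : Atoms) (k : ℕ) where
  open Atoms AT

  Agent : Set
  Agent = Fin (ℕ.suc k)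

  _≟atom_ : (p q : Atom) → Dec (p ≡ q)
  p ≟atom q with atomCode p ℕP.≟ atomCode q
  ... | yes e = yes (atomCode-injective e)
  ... | no ne = no (λ e → ne (cong atomCode e))

  infixr 6 _∧f_
  data Form : Set where
    atom : Atom → Form
    ~_   : Form → Form
    _∧f_ : Form → Form → Form
    □    : Agent → Form → Form
    [⇉]  : Form → Form

  ⊥f : Form
  ⊥f = atom atom₀ ∧f ~ atom atom₀

  ⊤f : Form
  ⊤f = ~ ⊥f

  _∨f_ : Form → Form → Form
  φ ∨f ψ = ~ (~ φ ∧f ~ ψ)

  _⇒_ : Form → Form → Form
  φ ⇒ ψ = ~ (φ ∧f ~ ψ)

  _⇔_ : Form → Form → Form
  φ ⇔ ψ = (φ ⇒ ψ) ∧f (ψ ⇒ φ)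

  ◇ : Agent → Form → Form
  ◇ a φ = ~ □ a (~ φ)

  ⟨⇉⟩ : Form → Form
  ⟨⇉⟩ φ = ~ [⇉] (~ φ)

  ⋀ : List Form → Form
  ⋀ [] = ⊤f
  ⋀ (φ ∷ Φ) = φ ∧f ⋀ Φ

  ⋁ : List Form → Form
  ⋁ [] = ⊥f
  ⋁ (φ ∷ Φ) = φ ∨f ⋁ Φ

  ⋀A : (Agent → Form) → Form
  ⋀A f = ⋀ (map f (allFin (ℕ.suc k)))

  ∇ : Agent → List Form → Form
  ∇ a Φ = ⋀ (map (◇ a) Φ) ∧f □ a (⋁ Φ)

  data IsProp : Form → Set where
    atom : ∀ p → IsProp (atom p)
    neg  : ∀ {φ} → IsProp φ → IsProp (~ φ)
    conj : ∀ {φ ψ} → IsProp φ → IsProp ψ → IsProp (φ ∧f ψ)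

  data IsModal : Form → Set where
    atom : ∀ p → IsModal (atom p)
    neg  : ∀ {φ} → IsModal φ → IsModal (~ φ)
    conj : ∀ {φ ψ} → IsModal φ → IsModal ψ → IsModal (φ ∧f ψ)
    box  : ∀ a {φ} → IsModal φ → IsModal (□ a φ)

  _[_/_] : Form → Form → Atom → Form
  atom q [ χ / p ] with q ≟atom p
  ... | yes _ = χ
  ... | no _ = atom q
  (~ φ) [ χ / p ] = ~ (φ [ χ / p ])
  (φ ∧f ψ) [ χ / p ] = (φ [ χ / p ]) ∧f (ψ [ χ / p ])
  □ a φ [ χ / p ] = □ a (φ [ χ / p ])
  [⇉] φ [ χ / p ] = [⇉] (φ [ χ / p ])

  -- tautologies (instances of propositional tautologies): true under every
  -- Boolean assignment to the non-Boolean subformulas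
  tv : (Form → Bool) → Form → Bool
  tv v (atom p) = v (atom p)
  tv v (~ φ) = not (tv v φ)
  tv v (φ ∧f ψ) = tv v φ && tv v ψ
  tv v (□ a φ) = v (□ a φ)
  tv v ([⇉] φ) = v ([⇉] φ)

  Taut : Form → Set
  Taut φ = ∀ (v : Form → Bool) → tv v φ ≡ true

  data ⊢K_ : Form → Set where
    prop : ∀ {φ} → IsModal φ → Taut φ → ⊢K φ
    K    : ∀ a {φ ψ} → IsModal φ → IsModal ψ → ⊢K (□ a (φ ⇒ ψ) ⇒ (□ a φ ⇒ □ a ψ))
    MP   : ∀ {φ ψ} → ⊢K φ → ⊢K (φ ⇒ ψ) → ⊢K ψ
    N    : ∀ a {φ} → ⊢K φ → ⊢K (□ a φ)

  Consistent : Form → Set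
  Consistent φ = ¬ (⊢K (~ φ))

  data ⊢_ : Form → Set where
    prop : ∀ {φ} → Taut φ → ⊢ φ
    K    : ∀ a φ ψ → ⊢ (□ a (φ ⇒ ψ) ⇒ (□ a φ ⇒ □ a ψ))
    MP   : ∀ {φ ψ} → ⊢ φ → ⊢ (φ ⇒ ψ) → ⊢ ψ
    N    : ∀ a {φ} → ⊢ φ → ⊢ (□ a φ)
    RE   : ∀ {χ ψ} (φ : Form) (p : Atom) → ⊢ (χ ⇔ ψ) → ⊢ ((φ [ χ / p ]) ⇔ (φ [ ψ / p ]))
    SQ1  : ∀ {φ₀} → IsProp φ₀ → ⊢ (⟨⇉⟩ φ₀ ⇔ φ₀)
    SQ2  : ∀ φ ψ → ⊢ (⟨⇉⟩ (φ ∨f ψ) ⇔ (⟨⇉⟩ φ ∨f ⟨⇉⟩ ψ))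
    SQ3  : ∀ {φ₀} φ → IsProp φ₀ → ⊢ (⟨⇉⟩ (φ₀ ∧f φ) ⇔ (φ₀ ∧f ⟨⇉⟩ φ))
    SQ4cons : (Φ : Agent → List Form) →
              (∀ a {φ} → φ ∈ Φ a → IsModal φ × Consistent φ) →
              ⊢ (⟨⇉⟩ (⋀A (λ a → ∇ a (Φ a)))
                  ⇔ ⋀A (λ a → □ a (⋁ (map ⟨⇉⟩ (Φ a)))))

  record Model : Set₁ where
    field
      S : Set
      stateCode : S → ℕ
      stateCode-injective : Injective _≡_ _≡_ stateCode
      R : Agent → S → S → Set
      V : S → Atom → Bool
  open Model

  IsSimulation : (M M' : Model) → (S M → S M' → Set) → Set
  IsSimulation M M' Z =
    ∀ s s' → Z s s' →
      (∀ p → V M s p ≡ V M' s' p) ×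
      (∀ a t → R M a s t → Σ (S M') λ t' → R M' a s' t' × Z t t')

  Simulates : (M : Model) → S M → (M' : Model) → S M' → Set₁
  Simulates M s M' s' = Σ (S M → S M' → Set) λ Z → IsSimulation M M' Z × Z s s'

  _,_⊨_ : (M : Model) → S M → Form → Set₁
  M , s ⊨ atom p = Lift _ (V M s p ≡ true)
  M , s ⊨ (~ φ) = ¬ (M , s ⊨ φ)
  M , s ⊨ (φ ∧f ψ) = (M , s ⊨ φ) × (M , s ⊨ ψ)
  M , s ⊨ □ a φ = ∀ t → R M a s t → M , t ⊨ φ
  M , s ⊨ [⇉] φ = ∀ (M' : Model) (s' : S M') → Simulates M s M' s' → M' , s' ⊨ φ

  Valid : Form → Set₁
  Valid φ = ∀ (M : Model) (s : S M) → M , s ⊨ φ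

{-# OPTIONS --safe #-}
-- Completeness via Hintikka types. Fix the atoms of φ and its modal depth d. A type of depth
-- d is a valuation of those atoms together with, for each agent, the list of types of depth
-- d - 1 of its successors; the characteristic formulas χ of all types of depth d form a
-- provable disjunction. Each χ is K-consistent (it holds at its own type), so SQ3 and SQ4cons
-- reduce ⟨⇉⟩ χ σ to boxes of ⟨⇉⟩ over successor types, and by induction ⊢ χ τ → ⟨⇉⟩ χ σ when
-- σ simulates τ as a finite tree (τ ≼ σ) and ⊢ χ τ → ¬ ⟨⇉⟩ χ σ otherwise. Hence χ τ proves φ
-- or ¬ φ according to a finite evaluation Sat τ φ in which [⇉] ranges over the ≼-larger
-- types. Semantically, a state realizing τ satisfies φ iff Sat τ φ: simulations only reach
-- ≼-larger types, and conversely, unravelling the model from the state and attaching the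
-- model of all types gives a simulating state of any ≼-larger type. Since every type is
-- realized in the model of all types, a valid φ is Sat at every type, so ⊢ χ τ → φ for every
-- τ, and ⊢ φ.
module Submission where

open import Defs
open import Level using (0ℓ; lift; lower)
open import Axiom.UniquenessOfIdentityProofs using (module Decidable⇒UIP)
open import Data.Bool using (Bool; true; false; not; _∧_; if_then_else_)
import Data.Bool as Bool
open import Data.Bool.Properties using (∧-conicalˡ; ∧-conicalʳ)
open import Data.Empty using (⊥; ⊥-elim)
open import Data.Fin using (Fin)
import Data.Fin as Fin
import Data.Fin.Properties as Finₚ
open import Data.List using (List; []; _∷_; map; _++_; allFin; length; filter; cartesianProduct; cartesianProductWith; deduplicate)
import Data.List as List
open import Data.List.Membership.Propositional using (_∈_; lose; find)
open import Data.List.Membership.Propositional.Properties using (∈-map⁺; ∈-map⁻; ∈-++⁺ˡ; ∈-++⁺ʳ; ∈-++⁻; ∈-cartesianProductWith⁺; ∈-cartesianProduct⁺; ∈-lookup; ∈-allFin; ∈-filter⁺; ∈-filter⁻; ∈-deduplicate⁺)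
import Data.List.Membership.Setoid.Properties as SetoidMembershipₚ
open import Data.List.Relation.Unary.All using (All; []; _∷_)
import Data.List.Relation.Unary.All as All
import Data.List.Relation.Unary.All.Properties as Allₚ
open import Data.List.Relation.Unary.Any using (Any; here; there)
import Data.List.Relation.Unary.Any as Any
import Data.List.Relation.Unary.Any.Properties as Anyₚ
open import Data.List.Relation.Unary.Unique.Propositional using (Unique)
import Data.List.Relation.Unary.Unique.DecPropositional.Properties as UniqueDecₚ
open import Data.Nat using (ℕ; zero; suc; _+_; _≤_; _<_; _⊔_; z≤n; s≤s)
import Data.Nat.Properties as ℕₚ
open import Data.Product using (Σ; ∃; _×_; _,_; proj₁; proj₂; map₁; map₂)
open import Data.Sum using (_⊎_; inj₁; inj₂; [_,_])
import Data.Sum as Sum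
open import Data.Unit using (⊤; tt)
open import Data.Vec using (Vec; []; _∷_)
import Data.Vec as Vec
import Data.Vec.Properties as Vecₚ
open import Effect.Monad using (RawMonad)
open import Function using (_∘_; id; case_of_)
open import Function.Bundles using (_↣_; mk↣; Injection)
open import Relation.Binary.Definitions using (tri<; tri≈; tri>)
open import Relation.Binary.PropositionalEquality using (_≡_; refl; sym; trans; cong; cong₂; subst; subst₂; setoid; module ≡-Reasoning)
open import Relation.Nullary using (¬_; Dec; yes; no; does; ¬?)
open import Relation.Nullary.Decidable using (decidable-stable; _×-dec_; _→-dec_; dec-true; ¬¬-excluded-middle)
open import Relation.Nullary.Negation using (¬¬-Monad; ¬¬-map)
open import Relation.Unary using (Decidable)

module Encodings where

  triangle : ℕ → ℕ
  triangle zero = zero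
  triangle (suc n) = triangle n + suc n

  triangle-mono : ∀ {m n} → m ≤ n → triangle m ≤ triangle n
  triangle-mono z≤n = z≤n
  triangle-mono (s≤s m≤n) = ℕₚ.+-mono-≤ (triangle-mono m≤n) (s≤s m≤n)

  -- Opaque, so that the implicit arguments of cantor-injective can be inferred.
  opaque
    cantor : ℕ → ℕ → ℕ
    cantor x y = triangle (x + y) + x

    cantor-diagonal : ∀ x y → triangle (x + y) ≤ cantor x y × cantor x y < triangle (suc (x + y))
    cantor-diagonal x y =
      ℕₚ.m≤m+n (triangle (x + y)) x , ℕₚ.+-monoʳ-< (triangle (x + y)) (s≤s (ℕₚ.m≤m+n x y))

    cantor-injective : ∀ {x y x′ y′} → cantor x y ≡ cantor x′ y′ → x ≡ x′ × y ≡ y′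
    cantor-injective {x} {y} {x′} {y′} eq with ℕₚ.<-cmp (x + y) (x′ + y′)
    ... | tri< lt _ _ = ⊥-elim (ℕₚ.<-irrefl eq (ℕₚ.<-≤-trans (proj₂ (cantor-diagonal x y))
                          (ℕₚ.≤-trans (triangle-mono lt) (proj₁ (cantor-diagonal x′ y′)))))
    ... | tri> _ _ gt = ⊥-elim (ℕₚ.<-irrefl (sym eq) (ℕₚ.<-≤-trans (proj₂ (cantor-diagonal x′ y′))
                          (ℕₚ.≤-trans (triangle-mono gt) (proj₁ (cantor-diagonal x y)))))
    ... | tri≈ _ same _ = x≡x′ , ℕₚ.+-cancelˡ-≡ x y y′ (trans same (cong (_+ y′) (sym x≡x′)))
      where
      x≡x′ : x ≡ x′
      x≡x′ = ℕₚ.+-cancelˡ-≡ (triangle (x + y)) x x′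
               (trans eq (cong (λ n → triangle n + x′) (sym same)))

  Countable : Set → Set
  Countable A = A ↣ ℕ

  private
    code : ∀ {A} → Countable A → A → ℕ
    code = Injection.to

    code-injective : ∀ {A} (c : Countable A) {x y} → code c x ≡ code c y → x ≡ y
    code-injective = Injection.injective

  bool-countable : Countable Bool
  bool-countable = mk↣ {to = λ b → if b then 1 else 0} injective
    where
    injective : ∀ {b c} → (if b then 1 else 0) ≡ (if c then 1 else 0) → b ≡ c
    injective {false} {false} _ = refl
    injective {true} {true} _ = refl

  fin-countable : ∀ {n} → Countable (Fin n)
  fin-countable = mk↣ Finₚ.toℕ-injective

  ×-countable : ∀ {A B} → Countable A → Countable B → Countable (A × B)
  ×-countable {A} {B} cA cB = mk↣ {to = to} injective
    where
    to : A × B → ℕ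
    to (a , b) = cantor (code cA a) (code cB b)
    injective : ∀ {x y} → to x ≡ to y → x ≡ y
    injective {a , b} {a′ , b′} eq with cantor-injective eq
    ... | a≡ , b≡ = cong₂ _,_ (code-injective cA a≡) (code-injective cB b≡)

  ⊎-countable : ∀ {A B} → Countable A → Countable B → Countable (A ⊎ B)
  ⊎-countable {A} {B} cA cB = mk↣ {to = to} injective
    where
    to : A ⊎ B → ℕ
    to (inj₁ a) = cantor 0 (code cA a)
    to (inj₂ b) = cantor 1 (code cB b)
    injective : ∀ {x y} → to x ≡ to y → x ≡ y
    injective {inj₁ a} {inj₁ a′} eq = cong inj₁ (code-injective cA (proj₂ (cantor-injective eq)))
    injective {inj₂ b} {inj₂ b′} eq = cong inj₂ (code-injective cB (proj₂ (cantor-injective eq)))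
    injective {inj₁ a} {inj₂ b} eq with () ← proj₁ (cantor-injective eq)
    injective {inj₂ b} {inj₁ a} eq with () ← proj₁ (cantor-injective eq)

  list-countable : ∀ {A} → Countable A → Countable (List A)
  list-countable {A} cA = mk↣ {to = to} injective
    where
    to : List A → ℕ
    to [] = 0
    to (x ∷ xs) = suc (cantor (code cA x) (to xs))
    injective : ∀ {xs ys} → to xs ≡ to ys → xs ≡ ys
    injective {[]} {[]} _ = refl
    injective {x ∷ xs} {y ∷ ys} eq with cantor-injective (ℕₚ.suc-injective eq)
    ... | x≡ , xs≡ = cong₂ _∷_ (code-injective cA x≡) (injective xs≡)

  vec-countable : ∀ {A n} → Countable A → Countable (Vec A n)
  vec-countable {A} cA = mk↣ {to = to} injective
    where
    to : ∀ {n} → Vec A n → ℕ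
    to [] = 0
    to (x ∷ xs) = cantor (code cA x) (to xs)
    injective : ∀ {n} {xs ys : Vec A n} → to xs ≡ to ys → xs ≡ ys
    injective {xs = []} {[]} _ = refl
    injective {xs = x ∷ xs} {y ∷ ys} eq with cantor-injective eq
    ... | x≡ , xs≡ = cong₂ _∷_ (code-injective cA x≡) (injective xs≡)

  Σℕ-countable : ∀ {B : ℕ → Set} → (∀ n → Countable (B n)) → Countable (Σ ℕ B)
  Σℕ-countable {B} cB = mk↣ {to = to} injective
    where
    to : Σ ℕ B → ℕ
    to (n , b) = cantor n (code (cB n) b)
    injective : ∀ {x y} → to x ≡ to y → x ≡ y
    injective {n , b} {n′ , b′} eq with cantor-injective eq
    ... | refl , b≡ = cong (n ,_) (code-injective (cB n) b≡)

module Lists {A : Set} where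

  index-∈-lookup : ∀ (xs : List A) i → Any.index (∈-lookup {xs = xs} i) ≡ i
  index-∈-lookup (x ∷ xs) Fin.zero = refl
  index-∈-lookup (x ∷ xs) (Fin.suc i) = cong Fin.suc (index-∈-lookup xs i)

  splits : List A → List (List A × List A)
  splits [] = ([] , []) ∷ []
  splits (x ∷ xs) = map (map₁ (x ∷_)) (splits xs) ++ map (map₂ (x ∷_)) (splits xs)

  sublists : List A → List (List A)
  sublists = map proj₁ ∘ splits

  splits-cover : ∀ {xs ys zs x} → (ys , zs) ∈ splits xs → x ∈ xs → x ∈ ys ⊎ x ∈ zs
  splits-cover {y ∷ xs} yzs∈ x∈ with ∈-++⁻ (map (map₁ (y ∷_)) (splits xs)) yzs∈
  ... | inj₁ left with ∈-map⁻ (map₁ (y ∷_)) left | x∈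
  ...   | _ , _ , refl | here refl = inj₁ (here refl)
  ...   | _ , yzs′∈ , refl | there x∈xs = Sum.map there id (splits-cover yzs′∈ x∈xs)
  splits-cover {y ∷ xs} yzs∈ x∈ | inj₂ right with ∈-map⁻ (map₂ (y ∷_)) right | x∈
  ...   | _ , _ , refl | here refl = inj₂ (here refl)
  ...   | _ , yzs′∈ , refl | there x∈xs = Sum.map id there (splits-cover yzs′∈ x∈xs)

  module _ {P : A → Set} where

    partitionBy : (xs : List A) → All (Dec ∘ P) xs → List A × List A
    partitionBy [] [] = [] , []
    partitionBy (x ∷ xs) (yes _ ∷ ds) = map₁ (x ∷_) (partitionBy xs ds)
    partitionBy (x ∷ xs) (no _ ∷ ds) = map₂ (x ∷_) (partitionBy xs ds)

    partitionBy-∈-splits : ∀ xs ds → partitionBy xs ds ∈ splits xs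
    partitionBy-∈-splits [] [] = here refl
    partitionBy-∈-splits (x ∷ xs) (yes _ ∷ ds) =
      ∈-++⁺ˡ (∈-map⁺ (map₁ (x ∷_)) (partitionBy-∈-splits xs ds))
    partitionBy-∈-splits (x ∷ xs) (no _ ∷ ds) =
      ∈-++⁺ʳ _ (∈-map⁺ (map₂ (x ∷_)) (partitionBy-∈-splits xs ds))

    partitionBy-accepted : ∀ xs ds → All P (proj₁ (partitionBy xs ds))
    partitionBy-accepted [] [] = []
    partitionBy-accepted (x ∷ xs) (yes px ∷ ds) = px ∷ partitionBy-accepted xs ds
    partitionBy-accepted (x ∷ xs) (no _ ∷ ds) = partitionBy-accepted xs ds

    ∈-partitionBy⁺ : ∀ {xs x} ds → x ∈ xs → P x → x ∈ proj₁ (partitionBy xs ds)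
    ∈-partitionBy⁺ (yes _ ∷ ds) (here refl) _ = here refl
    ∈-partitionBy⁺ (no ¬px ∷ ds) (here refl) px = ⊥-elim (¬px px)
    ∈-partitionBy⁺ (yes _ ∷ ds) (there x∈) px = there (∈-partitionBy⁺ ds x∈ px)
    ∈-partitionBy⁺ (no _ ∷ ds) (there x∈) px = ∈-partitionBy⁺ ds x∈ px

    partitionBy-rejected : ∀ xs ds → All (¬_ ∘ P) (proj₂ (partitionBy xs ds))
    partitionBy-rejected [] [] = []
    partitionBy-rejected (x ∷ xs) (yes _ ∷ ds) = partitionBy-rejected xs ds
    partitionBy-rejected (x ∷ xs) (no ¬px ∷ ds) = ¬px ∷ partitionBy-rejected xs ds

  vectors : List A → (n : ℕ) → List (Vec A n)
  vectors xs zero = [] ∷ []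
  vectors xs (suc n) = cartesianProductWith _∷_ xs (vectors xs n)

  ∈-vectors : ∀ {xs n} (v : Vec A n) → (∀ i → Vec.lookup v i ∈ xs) → v ∈ vectors xs n
  ∈-vectors [] _ = here refl
  ∈-vectors (x ∷ v) v⊆xs =
    ∈-cartesianProductWith⁺ _∷_ (v⊆xs Fin.zero) (∈-vectors v (v⊆xs ∘ Fin.suc))

  module _ {P : A → Set} (P? : Decidable P) where

    firstOr : A → List A → A
    firstOr d [] = d
    firstOr d (y ∷ ys) = if does (P? y) then y else firstOr d ys

    firstOr-satisfies : ∀ {d ys} → Any P ys → firstOr d ys ∈ ys × P (firstOr d ys)
    firstOr-satisfies {ys = y ∷ ys} any with P? y | any
    ... | yes py | _ = here refl , py
    ... | no ¬py | here py = ⊥-elim (¬py py)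
    ... | no _ | there any′ = map₁ there (firstOr-satisfies any′)

  firstOr-cong : ∀ {P Q : A → Set} (P? : Decidable P) (Q? : Decidable Q) {d d′ ys} →
                 (∀ y → P y → Q y) → (∀ y → Q y → P y) → Any P ys →
                 firstOr P? d ys ≡ firstOr Q? d′ ys
  firstOr-cong P? Q? {ys = y ∷ ys} P⊆Q Q⊆P any with P? y | Q? y | any
  ... | yes _ | yes _ | _ = refl
  ... | yes py | no ¬qy | _ = ⊥-elim (¬qy (P⊆Q y py))
  ... | no ¬py | yes qy | _ = ⊥-elim (¬py (Q⊆P y qy))
  ... | no ¬py | no _ | here py = ⊥-elim (¬py py)
  ... | no _ | no _ | there any′ = firstOr-cong P? Q? P⊆Q Q⊆P any′

module SMLReasoning (AT : Atoms) (k : ℕ) where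

  open Atoms AT
  open Logic AT k
  open Lists

  ⊥f-prop : IsProp ⊥f
  ⊥f-prop = conj (atom atom₀) (neg (atom atom₀))

  ⋀-prop : ∀ {Γ} → All IsProp Γ → IsProp (⋀ Γ)
  ⋀-prop [] = neg ⊥f-prop
  ⋀-prop (h ∷ hs) = conj h (⋀-prop hs)

  prop⇒modal : ∀ {φ} → IsProp φ → IsModal φ
  prop⇒modal (atom p) = atom p
  prop⇒modal (neg h) = neg (prop⇒modal h)
  prop⇒modal (conj h h′) = conj (prop⇒modal h) (prop⇒modal h′)

  ⋀-modal : ∀ {Γ} → All IsModal Γ → IsModal (⋀ Γ)
  ⋀-modal [] = prop⇒modal (⋀-prop [])
  ⋀-modal (h ∷ hs) = conj h (⋀-modal hs)

  ⋁-modal : ∀ {Γ} → All IsModal Γ → IsModal (⋁ Γ)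
  ⋁-modal [] = prop⇒modal ⊥f-prop
  ⋁-modal (h ∷ hs) = neg (conj (neg h) (neg (⋁-modal hs)))

  infix 4 _⊩_
  record _⊩_ (v : Form → Bool) (φ : Form) : Set where
    constructor mk⊩
    field evaluates-true : tv v φ ≡ true

  private
    not-true⁺ : ∀ {b} → ¬ b ≡ true → not b ≡ true
    not-true⁺ {false} _ = refl
    not-true⁺ {true} b≢true = ⊥-elim (b≢true refl)

    not-true⁻ : ∀ {b} → not b ≡ true → ¬ b ≡ true
    not-true⁻ {false} _ ()

  module _ {v : Form → Bool} where

    ⊩-dec : ∀ φ → Dec (v ⊩ φ)
    ⊩-dec φ with tv v φ in eq
    ... | true = yes (mk⊩ eq)
    ... | false = no λ { (mk⊩ eq′) → case trans (sym eq) eq′ of λ () }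

    ⊩-stable : ∀ {φ} → ¬ ¬ v ⊩ φ → v ⊩ φ
    ⊩-stable {φ} = decidable-stable (⊩-dec φ)

    ~-intro : ∀ {φ} → ¬ v ⊩ φ → v ⊩ ~ φ
    ~-intro ¬φ = mk⊩ (not-true⁺ (¬φ ∘ mk⊩))

    ~-elim : ∀ {φ} → v ⊩ ~ φ → ¬ v ⊩ φ
    ~-elim (mk⊩ h) (mk⊩ t) = not-true⁻ h t

    ∧-intro : ∀ {φ ψ} → v ⊩ φ → v ⊩ ψ → v ⊩ φ ∧f ψ
    ∧-intro (mk⊩ p) (mk⊩ q) = mk⊩ (cong₂ _∧_ p q)

    ∧-elimˡ : ∀ {φ ψ} → v ⊩ φ ∧f ψ → v ⊩ φ
    ∧-elimˡ {φ} {ψ} (mk⊩ h) = mk⊩ (∧-conicalˡ (tv v φ) (tv v ψ) h)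

    ∧-elimʳ : ∀ {φ ψ} → v ⊩ φ ∧f ψ → v ⊩ ψ
    ∧-elimʳ {φ} {ψ} (mk⊩ h) = mk⊩ (∧-conicalʳ (tv v φ) (tv v ψ) h)

    ⇒-intro : ∀ {φ ψ} → (v ⊩ φ → v ⊩ ψ) → v ⊩ φ ⇒ ψ
    ⇒-intro f = ~-intro λ c → ~-elim (∧-elimʳ c) (f (∧-elimˡ c))

    ⇒-elim : ∀ {φ ψ} → v ⊩ φ ⇒ ψ → v ⊩ φ → v ⊩ ψ
    ⇒-elim h p = ⊩-stable λ ¬q → ~-elim h (∧-intro p (~-intro ¬q))

    ⇔-elimˡ : ∀ {φ ψ} → v ⊩ φ ⇔ ψ → v ⊩ φ → v ⊩ ψ
    ⇔-elimˡ = ⇒-elim ∘ ∧-elimˡ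

    ⇔-elimʳ : ∀ {φ ψ} → v ⊩ φ ⇔ ψ → v ⊩ ψ → v ⊩ φ
    ⇔-elimʳ = ⇒-elim ∘ ∧-elimʳ

    ∨-introˡ : ∀ {φ ψ} → v ⊩ φ → v ⊩ φ ∨f ψ
    ∨-introˡ p = ~-intro λ c → ~-elim (∧-elimˡ c) p

    ∨-introʳ : ∀ {φ ψ} → v ⊩ ψ → v ⊩ φ ∨f ψ
    ∨-introʳ q = ~-intro λ c → ~-elim (∧-elimʳ c) q

    ∨-elim : ∀ {φ ψ} → v ⊩ φ ∨f ψ → v ⊩ φ ⊎ v ⊩ ψ
    ∨-elim {φ} h with ⊩-dec φ
    ... | yes p = inj₁ p
    ... | no ¬p = inj₂ (⊩-stable λ ¬q → ~-elim h (∧-intro (~-intro ¬p) (~-intro ¬q)))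

    ⊥-elim-⊩ : ¬ v ⊩ ⊥f
    ⊥-elim-⊩ h = ~-elim (∧-elimʳ h) (∧-elimˡ h)

    ⊤-intro : v ⊩ ⊤f
    ⊤-intro = ~-intro ⊥-elim-⊩

    ⋀-intro : ∀ {Γ} → All (v ⊩_) Γ → v ⊩ ⋀ Γ
    ⋀-intro [] = ⊤-intro
    ⋀-intro (p ∷ ps) = ∧-intro p (⋀-intro ps)

    ⋀-elim : ∀ {Γ} → v ⊩ ⋀ Γ → All (v ⊩_) Γ
    ⋀-elim {[]} _ = []
    ⋀-elim {φ ∷ Γ} h = ∧-elimˡ h ∷ ⋀-elim (∧-elimʳ h)

    ⋁-intro : ∀ {Γ} → Any (v ⊩_) Γ → v ⊩ ⋁ Γ
    ⋁-intro (here p) = ∨-introˡ p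
    ⋁-intro (there ps) = ∨-introʳ (⋁-intro ps)

    ⋁-elim : ∀ {Γ} → v ⊩ ⋁ Γ → Any (v ⊩_) Γ
    ⋁-elim {[]} h = ⊥-elim (⊥-elim-⊩ h)
    ⋁-elim {φ ∷ Γ} h with ∨-elim h
    ... | inj₁ p = here p
    ... | inj₂ ps = there (⋁-elim ps)

  ⋀A-intro : ∀ {v} {f : Agent → Form} → (∀ a → v ⊩ f a) → v ⊩ ⋀A f
  ⋀A-intro h = ⋀-intro (Allₚ.map⁺ (All.tabulate λ {a} _ → h a))

  ⋀A-elim : ∀ {v} {f : Agent → Form} → v ⊩ ⋀A f → ∀ a → v ⊩ f a
  ⋀A-elim h a = All.lookup (Allₚ.map⁻ (⋀-elim h)) (∈-allFin a)

  ∇-◇ : ∀ {v a} {X : Set} {f : X → Form} {xs x} → v ⊩ ∇ a (map f xs) → x ∈ xs → v ⊩ ◇ a (f x)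
  ∇-◇ h x∈ = All.lookup (Allₚ.map⁻ (Allₚ.map⁻ (⋀-elim (∧-elimˡ h)))) x∈

  taut : ∀ {φ} → (∀ v → v ⊩ φ) → ⊢ φ
  taut h = prop (_⊩_.evaluates-true ∘ h)

  taut-All : ∀ {Γ φ} → All ⊢_ Γ → (∀ {v} → All (v ⊩_) Γ → v ⊩ φ) → ⊢ φ
  taut-All [] f = taut λ _ → f []
  taut-All (d ∷ ds) f = MP d (taut-All ds λ hs → ⇒-intro λ h → f (h ∷ hs))

  taut₁ : ∀ {ψ φ} → ⊢ ψ → (∀ {v} → v ⊩ ψ → v ⊩ φ) → ⊢ φ
  taut₁ d f = taut-All (d ∷ []) λ { (h ∷ []) → f h }

  taut₂ : ∀ {ψ₁ ψ₂ φ} → ⊢ ψ₁ → ⊢ ψ₂ →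
          (∀ {v} → v ⊩ ψ₁ → v ⊩ ψ₂ → v ⊩ φ) → ⊢ φ
  taut₂ d₁ d₂ f = taut-All (d₁ ∷ d₂ ∷ []) λ { (h₁ ∷ h₂ ∷ []) → f h₁ h₂ }

  ⋁-cases : ∀ {X : Set} {f : X → Form} {ψ} xs →
            (∀ {x} → x ∈ xs → ⊢ (f x ⇒ ψ)) → ⊢ (⋁ (map f xs) ⇒ ψ)
  ⋁-cases [] _ = taut λ _ → ⇒-intro (⊥-elim ∘ ⊥-elim-⊩)
  ⋁-cases (x ∷ xs) cases = taut₂ (cases (here refl)) (⋁-cases xs (cases ∘ there)) λ case₁ case₂ →
    ⇒-intro λ h → [ ⇒-elim case₁ , ⇒-elim case₂ ] (∨-elim h)

  ⋁-map-cases : ∀ {X : Set} (g : Form → Form) (f : X → Form) {ψ} xs →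
                (∀ {x} → x ∈ xs → ⊢ (g (f x) ⇒ ψ)) → ⊢ (⋁ (map g (map f xs)) ⇒ ψ)
  ⋁-map-cases g f xs cases = ⋁-cases (map f xs) λ φ∈ → case ∈-map⁻ f φ∈ of λ where
    (x , x∈ , refl) → cases x∈

  ⋀-mono : ∀ {X : Set} {f g : X → Form} xs →
           (∀ {x} → x ∈ xs → ⊢ (f x ⇒ g x)) → ⊢ (⋀ (map f xs) ⇒ ⋀ (map g xs))
  ⋀-mono [] _ = taut λ _ → ⇒-intro λ _ → ⊤-intro
  ⋀-mono (x ∷ xs) mono = taut₂ (mono (here refl)) (⋀-mono xs (mono ∘ there)) λ mono₁ mono₂ →
    ⇒-intro λ h → ∧-intro (⇒-elim mono₁ (∧-elimˡ h)) (⇒-elim mono₂ (∧-elimʳ h))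

  ⋀A-mono : ∀ {f g : Agent → Form} → (∀ a → ⊢ (f a ⇒ g a)) → ⊢ (⋀A f ⇒ ⋀A g)
  ⋀A-mono mono = ⋀-mono (allFin _) λ {a} _ → mono a

  ⊢⇒-trans : ∀ {φ ψ ρ} → ⊢ (φ ⇒ ψ) → ⊢ (ψ ⇒ ρ) → ⊢ (φ ⇒ ρ)
  ⊢⇒-trans d₁ d₂ = taut₂ d₁ d₂ λ h₁ h₂ → ⇒-intro (⇒-elim h₂ ∘ ⇒-elim h₁)

  □-mono : ∀ a {φ ψ} → ⊢ (φ ⇒ ψ) → ⊢ (□ a φ ⇒ □ a ψ)
  □-mono a {φ} {ψ} h = MP (N a h) (K a φ ψ)

  RK : ∀ a Γ {ψ} → ⊢ (⋀ Γ ⇒ ψ) → ⊢ (⋀ (map (□ a) Γ) ⇒ □ a ψ)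
  RK a [] h = taut₁ (N a (taut₁ h λ h′ → ⇒-elim h′ ⊤-intro)) λ □ψ → ⇒-intro λ _ → □ψ
  RK a (γ ∷ Γ) {ψ} h = taut₂ (RK a Γ (taut₁ h curried)) (K a γ ψ) λ ih k →
    ⇒-intro λ c → ⇒-elim (⇒-elim k (⇒-elim ih (∧-elimʳ c))) (∧-elimˡ c)
    where
    curried : ∀ {v} → v ⊩ (⋀ (γ ∷ Γ) ⇒ ψ) → v ⊩ (⋀ Γ ⇒ (γ ⇒ ψ))
    curried h′ = ⇒-intro λ hΓ → ⇒-intro λ hγ → ⇒-elim h′ (∧-intro hγ hΓ)

  [/]-atom : ∀ p χ → atom p [ χ / p ] ≡ χ
  [/]-atom p χ with p ≟atom p
  ... | yes _ = refl
  ... | no p≢p = ⊥-elim (p≢p refl)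

  [⇉]-cong : ∀ {χ ψ} → ⊢ (χ ⇔ ψ) → ⊢ ([⇉] χ ⇔ [⇉] ψ)
  [⇉]-cong {χ} {ψ} h = subst₂ (λ χ′ ψ′ → ⊢ ([⇉] χ′ ⇔ [⇉] ψ′)) ([/]-atom atom₀ χ) ([/]-atom atom₀ ψ)
                              (RE ([⇉] (atom atom₀)) atom₀ h)

  ⟨⇉⟩-cong : ∀ {χ ψ} → ⊢ (χ ⇔ ψ) → ⊢ (⟨⇉⟩ χ ⇔ ⟨⇉⟩ ψ)
  ⟨⇉⟩-cong h = taut₁ ([⇉]-cong (taut₁ h negated)) negated
    where
    negated : ∀ {v φ ψ} → v ⊩ (φ ⇔ ψ) → v ⊩ ((~ φ) ⇔ (~ ψ))
    negated h′ = ∧-intro (⇒-intro λ ¬φ → ~-intro (~-elim ¬φ ∘ ⇔-elimʳ h′))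
                         (⇒-intro λ ¬ψ → ~-intro (~-elim ¬ψ ∘ ⇔-elimˡ h′))

  ⟨⇉⟩-mono : ∀ {φ ψ} → ⊢ (φ ⇒ ψ) → ⊢ (⟨⇉⟩ φ ⇒ ⟨⇉⟩ ψ)
  ⟨⇉⟩-mono {φ} {ψ} h = taut₂ (⟨⇉⟩-cong (taut₁ h absorb)) (SQ2 φ ψ) λ cong-∨ sq2 →
    ⇒-intro λ h′ → ⇔-elimˡ cong-∨ (⇔-elimʳ sq2 (∨-introˡ h′))
    where
    absorb : ∀ {v} → v ⊩ (φ ⇒ ψ) → v ⊩ ((φ ∨f ψ) ⇔ ψ)
    absorb h′ = ∧-intro (⇒-intro λ h″ → [ ⇒-elim h′ , id ] (∨-elim h″)) (⇒-intro ∨-introʳ)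

  ⟨⇉⟩-⋁ : ∀ Γ → ⊢ (⟨⇉⟩ (⋁ Γ) ⇒ ⋁ (map ⟨⇉⟩ Γ))
  ⟨⇉⟩-⋁ [] = taut₁ (SQ1 ⊥f-prop) (⇒-intro ∘ ⇔-elimˡ)
  ⟨⇉⟩-⋁ (φ ∷ Γ) = taut₂ (SQ2 φ (⋁ Γ)) (⟨⇉⟩-⋁ Γ) λ sq2 ih →
    ⇒-intro λ h → [ ∨-introˡ , ∨-introʳ ∘ ⇒-elim ih ] (∨-elim (⇔-elimˡ sq2 h))

  [⇉]-dual : ∀ φ → ⊢ ([⇉] φ ⇔ (~ ⟨⇉⟩ (~ φ)))
  [⇉]-dual φ = taut₁ ([⇉]-cong (taut λ _ → ∧-intro (⇒-intro ¬¬-intro) (⇒-intro ¬¬-elim))) λ h →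
    ∧-intro (⇒-intro (¬¬-intro ∘ ⇔-elimˡ h)) (⇒-intro (⇔-elimʳ h ∘ ¬¬-elim))
    where
    ¬¬-intro : ∀ {v ψ} → v ⊩ ψ → v ⊩ ~ ~ ψ
    ¬¬-intro h = ~-intro λ n → ~-elim n h
    ¬¬-elim : ∀ {v ψ} → v ⊩ ~ ~ ψ → v ⊩ ψ
    ¬¬-elim h = ⊩-stable (~-elim h ∘ ~-intro)

  ∇-cover : ∀ a {X : Set} (f : X → Form) xs →
            ⊢ ⋁ (map f xs) → ⊢ ⋁ (map (λ ys → ∇ a (map f ys)) (sublists xs))
  ∇-cover a f xs ⊢⋁f = taut-All (Allₚ.map⁺ (All.tabulate split-□)) λ {v} hs →
    let ds = All.tabulate {xs = xs} λ {x} _ → ⊩-dec (◇ a (f x))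
        yz∈ = partitionBy-∈-splits xs ds
        ◇ys = ⋀-intro (Allₚ.map⁺ (Allₚ.map⁺ (partitionBy-accepted xs ds)))
        □zs = ⋀-intro (Allₚ.map⁺ (Allₚ.map⁺
                (All.map (λ ¬◇ → ⊩-stable (¬◇ ∘ ~-intro)) (partitionBy-rejected xs ds))))
        □ys = ⇒-elim (All.lookup (Allₚ.map⁻ hs) yz∈) □zs
    in ⋁-intro (Anyₚ.map⁺ (Anyₚ.map⁺ (lose yz∈ (∧-intro ◇ys □ys))))
    where
    split-□ : ∀ {yzs} → yzs ∈ splits xs →
              ⊢ (⋀ (map (□ a) (map (~_ ∘ f) (proj₂ yzs))) ⇒ □ a (⋁ (map f (proj₁ yzs))))
    split-□ {ys , zs} yz∈ =
      taut₂ (N a ⊢⋁f) (RK a (⋁ (map f xs) ∷ map (~_ ∘ f) zs) (taut λ _ → ⇒-intro covered))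
      λ □⋁f rk → ⇒-intro λ □zs → ⇒-elim rk (∧-intro □⋁f □zs)
      where
      covered : ∀ {v} → v ⊩ ⋀ (⋁ (map f xs) ∷ map (~_ ∘ f) zs) → v ⊩ ⋁ (map f ys)
      covered h with ⋀-elim h
      ... | ⋁f ∷ ¬fzs with find (Anyₚ.map⁻ (⋁-elim ⋁f))
      ...   | x , x∈ , fx with splits-cover yz∈ x∈
      ...     | inj₁ x∈ys = ⋁-intro (Anyₚ.map⁺ (lose x∈ys fx))
      ...     | inj₂ x∈zs = ⊥-elim (~-elim (All.lookup (Allₚ.map⁻ ¬fzs) x∈zs) fx)

  atoms : Form → List Atom
  atoms (atom p) = p ∷ []
  atoms (~ φ) = atoms φ
  atoms (φ ∧f ψ) = atoms φ ++ atoms ψ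
  atoms (□ a φ) = atoms φ
  atoms ([⇉] φ) = atoms φ

  modalDepth : Form → ℕ
  modalDepth (atom p) = zero
  modalDepth (~ φ) = modalDepth φ
  modalDepth (φ ∧f ψ) = modalDepth φ ⊔ modalDepth ψ
  modalDepth (□ a φ) = suc (modalDepth φ)
  modalDepth ([⇉] φ) = modalDepth φ

module CharacteristicFormulas (AT : Atoms) (k : ℕ) (As : List (Atoms.Atom AT)) (As-unique : Unique As) where

  open Atoms AT
  open Logic AT k
  open SMLReasoning AT k
  open Lists
  open import Data.List.Membership.DecPropositional _≟atom_ using (_∈?_)

  Valuation : Set
  Valuation = Vec Bool (length As)

  Agrees : (Atom → Bool) → Valuation → Set
  Agrees f b = ∀ i → f (List.lookup As i) ≡ Vec.lookup b i

  agrees-unique : ∀ {f} b b′ → Agrees f b → Agrees f b′ → b ≡ b′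
  agrees-unique b b′ f≈b f≈b′ = begin
    b                        ≡⟨ Vecₚ.tabulate∘lookup b ⟨
    Vec.tabulate (Vec.lookup b)  ≡⟨ Vecₚ.tabulate-cong (λ i → trans (sym (f≈b i)) (f≈b′ i)) ⟩
    Vec.tabulate (Vec.lookup b′) ≡⟨ Vecₚ.tabulate∘lookup b′ ⟩
    b′                       ∎
    where open ≡-Reasoning

  valuationOf : Valuation → Atom → Bool
  valuationOf b p with p ∈? As
  ... | yes p∈ = Vec.lookup b (Any.index p∈)
  ... | no _ = false

  valuationOf-agrees : ∀ b → Agrees (valuationOf b) b
  valuationOf-agrees b i with List.lookup As i ∈? As
  ... | no p∉ = ⊥-elim (p∉ (∈-lookup i))
  ... | yes p∈ = cong (Vec.lookup b) (trans (cong Any.index membership-unique) (index-∈-lookup As i))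
    where
    membership-unique : p∈ ≡ ∈-lookup i
    membership-unique = SetoidMembershipₚ.unique⇒irrelevant (setoid Atom) (Decidable⇒UIP.≡-irrelevant _≟atom_)
                          As-unique p∈ (∈-lookup i)

  agrees-valuationOf : ∀ f b {p} → Agrees f b → p ∈ As → f p ≡ valuationOf b p
  agrees-valuationOf f b {p} f≈b p∈ = begin
    f p                      ≡⟨ cong f p≡ ⟩
    f (List.lookup As i)     ≡⟨ f≈b i ⟩
    Vec.lookup b i           ≡⟨ valuationOf-agrees b i ⟨
    valuationOf b (List.lookup As i) ≡⟨ cong (valuationOf b) p≡ ⟨
    valuationOf b p          ∎
    where
    open ≡-Reasoning
    i = Any.index p∈
    p≡ : p ≡ List.lookup As i
    p≡ = Anyₚ.lookup-index p∈

  agreeing : (Atom → Bool) → Valuation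
  agreeing f = Vec.tabulate (f ∘ List.lookup As)

  agreeing-agrees : ∀ f → Agrees f (agreeing f)
  agreeing-agrees f i = sym (Vecₚ.lookup∘tabulate (f ∘ List.lookup As) i)

  allValuations : List Valuation
  allValuations = vectors (true ∷ false ∷ []) (length As)

  ∈-allValuations : ∀ b → b ∈ allValuations
  ∈-allValuations b = ∈-vectors b λ i → bool∈ (Vec.lookup b i)
    where
    bool∈ : ∀ c → c ∈ true ∷ false ∷ []
    bool∈ true = here refl
    bool∈ false = there (here refl)

  literal : Atom → Bool → Form
  literal p true = atom p
  literal p false = ~ atom p

  lits : Valuation → Form
  lits b = ⋀ (map (λ i → literal (List.lookup As i) (Vec.lookup b i)) (allFin (length As)))

  module _ {v : Form → Bool} where

    ⊩-lits⁺ : ∀ b → Agrees (v ∘ atom) b → v ⊩ lits b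
    ⊩-lits⁺ b v≈b = ⋀-intro (Allₚ.map⁺ (All.tabulate λ {i} _ → ⊩-literal (v≈b i)))
      where
      ⊩-literal : ∀ {p c} → v (atom p) ≡ c → v ⊩ literal p c
      ⊩-literal {c = true} eq = mk⊩ eq
      ⊩-literal {c = false} eq = ~-intro λ { (mk⊩ eq′) → case trans (sym eq) eq′ of λ () }

    ⊩-lits⁻ : ∀ b → v ⊩ lits b → Agrees (v ∘ atom) b
    ⊩-lits⁻ b h i = literal-⊩ (All.lookup (Allₚ.map⁻ (⋀-elim h)) (∈-allFin i))
      where
      literal-⊩ : ∀ {p c} → v ⊩ literal p c → v (atom p) ≡ c
      literal-⊩ {p} {true} (mk⊩ eq) = eq
      literal-⊩ {p} {false} h′ with v (atom p) in eq
      ... | false = refl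
      ... | true = ⊥-elim (~-elim h′ (mk⊩ eq))

    lits-unique : ∀ b b′ → v ⊩ lits b → v ⊩ lits b′ → b ≡ b′
    lits-unique b b′ h h′ = agrees-unique {v ∘ atom} b b′ (⊩-lits⁻ b h) (⊩-lits⁻ b′ h′)

  lits-prop : ∀ b → IsProp (lits b)
  lits-prop b = ⋀-prop (Allₚ.map⁺ (All.tabulate λ {i} _ → literal-prop (List.lookup As i) (Vec.lookup b i)))
    where
    literal-prop : ∀ p c → IsProp (literal p c)
    literal-prop p true = atom p
    literal-prop p false = neg (atom p)

  -- Hintikka types; at depth suc e they list, for each agent, the types of the successors.
  Ty : ℕ → Set
  Ty zero = Valuation
  Ty (suc e) = Valuation × Vec (List (Ty e)) (suc k)

  val : ∀ {d} → Ty d → Valuation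
  val {zero} b = b
  val {suc e} (b , _) = b

  succs : ∀ {e} → Ty (suc e) → Agent → List (Ty e)
  succs (_ , Ψ) a = Vec.lookup Ψ a

  χ : ∀ {d} → Ty d → Form
  χ {zero} b = lits b
  χ {suc e} (b , Ψ) = lits b ∧f ⋀A (λ a → ∇ a (map χ (Vec.lookup Ψ a)))

  infix 4 _≼_ _≼?_
  _≼_ : ∀ {d} → Ty d → Ty d → Set
  _≼_ {zero} b b′ = b ≡ b′
  _≼_ {suc e} τ σ = val τ ≡ val σ × (∀ a → All (λ x → Any (x ≼_) (succs σ a)) (succs τ a))

  _≼?_ : ∀ {d} (τ σ : Ty d) → Dec (τ ≼ σ)
  _≼?_ {zero} b b′ = Vecₚ.≡-dec Bool._≟_ b b′
  _≼?_ {suc e} τ σ = Vecₚ.≡-dec Bool._≟_ (val τ) (val σ)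
    ×-dec Finₚ.all? λ a → All.all? (λ x → Any.any? (x ≼?_) (succs σ a)) (succs τ a)

  ≼-val : ∀ {d} {τ σ : Ty d} → τ ≼ σ → val τ ≡ val σ
  ≼-val {zero} eq = eq
  ≼-val {suc e} (eq , _) = eq

  ≼-trans : ∀ {d} {τ σ ρ : Ty d} → τ ≼ σ → σ ≼ ρ → τ ≼ ρ
  ≼-trans {zero} = trans
  ≼-trans {suc e} (eq₁ , sim₁) (eq₂ , sim₂) = trans eq₁ eq₂ , λ a → All.map (step a) (sim₁ a)
    where
    step : ∀ a {x} → Any (x ≼_) _ → Any (x ≼_) _
    step a x≼ with find x≼
    ... | y , y∈ , x≼y with find (All.lookup (sim₂ a) y∈)
    ...   | z , z∈ , y≼z = lose z∈ (≼-trans x≼y y≼z)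

  -- Only types whose successor lists are sublists of allTy e, which suffices for ⊢-cover
  -- and realizes-some.
  allTy : ∀ d → List (Ty d)
  allTy zero = allValuations
  allTy (suc e) = cartesianProduct allValuations (vectors (sublists (allTy e)) (suc k))

  ∈-allTy-suc : ∀ {e} b (Ψ : Vec (List (Ty e)) (suc k)) →
                (∀ a → Vec.lookup Ψ a ∈ sublists (allTy e)) → (b , Ψ) ∈ allTy (suc e)
  ∈-allTy-suc b Ψ Ψ⊆ = ∈-cartesianProduct⁺ (∈-allValuations b) (∈-vectors Ψ Ψ⊆)

  -- Depth-0 types are dead ends, so every □-formula holds there; this keeps Sat sound for K.
  Sat : ∀ {d} → Ty d → Form → Set
  Sat τ (atom p) = valuationOf (val τ) p ≡ true
  Sat τ (~ φ) = ¬ Sat τ φ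
  Sat τ (φ ∧f ψ) = Sat τ φ × Sat τ ψ
  Sat {zero} τ (□ a φ) = ⊤
  Sat {suc e} τ (□ a φ) = All (λ x → Sat x φ) (succs τ a)
  Sat {d} τ ([⇉] φ) = All (λ σ → τ ≼ σ → Sat σ φ) (allTy d)

  Sat? : ∀ {d} (τ : Ty d) φ → Dec (Sat τ φ)
  Sat? τ (atom p) = valuationOf (val τ) p Bool.≟ true
  Sat? τ (~ φ) = ¬? (Sat? τ φ)
  Sat? τ (φ ∧f ψ) = Sat? τ φ ×-dec Sat? τ ψ
  Sat? {zero} τ (□ a φ) = yes tt
  Sat? {suc e} τ (□ a φ) = All.all? (λ x → Sat? x φ) (succs τ a)
  Sat? {d} τ ([⇉] φ) = All.all? (λ σ → (τ ≼? σ) →-dec Sat? σ φ) (allTy d)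

  Sat-stable : ∀ {d} (τ : Ty d) φ → ¬ ¬ Sat τ φ → Sat τ φ
  Sat-stable τ φ = decidable-stable (Sat? τ φ)

  -- Sat as a Boolean valuation, so that propositional reasoning about Sat goes through ⊩.
  satᵛ : ∀ {d} → Ty d → Form → Bool
  satᵛ τ φ = does (Sat? τ φ)

  tv-satᵛ : ∀ {d} (τ : Ty d) φ → tv (satᵛ τ) φ ≡ satᵛ τ φ
  tv-satᵛ τ (atom p) = refl
  tv-satᵛ τ (~ φ) = cong not (tv-satᵛ τ φ)
  tv-satᵛ τ (φ ∧f ψ) = cong₂ _∧_ (tv-satᵛ τ φ) (tv-satᵛ τ ψ)
  tv-satᵛ τ (□ a φ) = refl
  tv-satᵛ τ ([⇉] φ) = refl

  Sat⇒⊩ : ∀ {d} (τ : Ty d) φ → Sat τ φ → satᵛ τ ⊩ φ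
  Sat⇒⊩ τ φ s = mk⊩ (trans (tv-satᵛ τ φ) (dec-true (Sat? τ φ) s))

  ⊩⇒Sat : ∀ {d} (τ : Ty d) φ → satᵛ τ ⊩ φ → Sat τ φ
  ⊩⇒Sat τ φ (mk⊩ h) = does-true (Sat? τ φ) (trans (sym (tv-satᵛ τ φ)) h)
    where
    does-true : ∀ {P : Set} (P? : Dec P) → does P? ≡ true → P
    does-true (yes p) _ = p

  Sat-⇒ : ∀ {d} (τ : Ty d) {φ ψ} → Sat τ (φ ⇒ ψ) → Sat τ φ → Sat τ ψ
  Sat-⇒ τ {φ} {ψ} φ⇒ψ φ′ = ⊩⇒Sat τ ψ (⇒-elim (Sat⇒⊩ τ (φ ⇒ ψ) φ⇒ψ) (Sat⇒⊩ τ φ φ′))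

  Sat-sound : ∀ {φ} → ⊢K φ → ∀ {d} (τ : Ty d) → Sat τ φ
  Sat-sound (prop {φ} _ t) τ = ⊩⇒Sat τ φ (mk⊩ (t (satᵛ τ)))
  Sat-sound (K a {φ} {ψ} _ _) {zero} τ =
    ⊩⇒Sat τ (□ a (φ ⇒ ψ) ⇒ (□ a φ ⇒ □ a ψ)) (⇒-intro λ _ → ⇒-intro λ _ → Sat⇒⊩ τ (□ a ψ) tt)
  Sat-sound (K a {φ} {ψ} _ _) {suc e} τ =
    ⊩⇒Sat τ (□ a (φ ⇒ ψ) ⇒ (□ a φ ⇒ □ a ψ)) (⇒-intro λ □φ⇒ψ → ⇒-intro λ □φ →
      Sat⇒⊩ τ (□ a ψ) (All.zipWith (λ (φ⇒ψ , φ′) → Sat-⇒ _ φ⇒ψ φ′)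
                                   (⊩⇒Sat τ (□ a (φ ⇒ ψ)) □φ⇒ψ , ⊩⇒Sat τ (□ a φ) □φ)))
  Sat-sound (MP d₁ d₂) τ = Sat-⇒ τ (Sat-sound d₂ τ) (Sat-sound d₁ τ)
  Sat-sound (N a d) {zero} τ = tt
  Sat-sound (N a d) {suc e} τ = All.tabulate λ {x} _ → Sat-sound d x

  χ-satisfied : ∀ {d} (τ : Ty d) → Sat τ (χ τ)
  χ-satisfied τ = ⊩⇒Sat τ (χ τ) (χ-⊩ τ)
    where
    lits-⊩ : ∀ {d} (τ : Ty d) → satᵛ τ ⊩ lits (val τ)
    lits-⊩ τ = ⊩-lits⁺ (val τ) λ i →
      trans (does-≟-true (valuationOf (val τ) (List.lookup As i))) (valuationOf-agrees (val τ) i)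
      where
      does-≟-true : ∀ c → does (c Bool.≟ true) ≡ c
      does-≟-true true = refl
      does-≟-true false = refl
    χ-⊩ : ∀ {d} (τ : Ty d) → satᵛ τ ⊩ χ τ
    χ-⊩ {zero} τ = lits-⊩ τ
    χ-⊩ {suc e} τ = ∧-intro (lits-⊩ τ) (⋀A-intro λ a → ∧-intro (◇-⊩ a) (□-⊩ a))
      where
      ◇-⊩ : ∀ a → satᵛ τ ⊩ ⋀ (map (◇ a) (map χ (succs τ a)))
      ◇-⊩ a = ⋀-intro (Allₚ.map⁺ (Allₚ.map⁺ (All.tabulate λ {x} x∈ →
        Sat⇒⊩ τ (◇ a (χ x)) λ □¬χx → All.lookup □¬χx x∈ (⊩⇒Sat x (χ x) (χ-⊩ x)))))
      □-⊩ : ∀ a → satᵛ τ ⊩ □ a (⋁ (map χ (succs τ a)))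
      □-⊩ a = Sat⇒⊩ τ (□ a _) (All.tabulate λ {y} y∈ →
        ⊩⇒Sat y _ (⋁-intro (Anyₚ.map⁺ (lose y∈ (χ-⊩ y)))))

  χ-consistent : ∀ {d} (τ : Ty d) → Consistent (χ τ)
  χ-consistent τ ⊢¬χ = Sat-sound ⊢¬χ τ (χ-satisfied τ)

  χ-modal : ∀ {d} (τ : Ty d) → IsModal (χ τ)
  χ-modal {zero} b = prop⇒modal (lits-prop b)
  χ-modal {suc e} (b , Ψ) =
    conj (prop⇒modal (lits-prop b)) (⋀-modal (Allₚ.map⁺ (All.tabulate λ {a} _ → ∇-modal a)))
    where
    ∇-modal : ∀ a → IsModal (∇ a (map χ (Vec.lookup Ψ a)))
    ∇-modal a =
      conj (⋀-modal (Allₚ.map⁺ (Allₚ.map⁺ (All.tabulate λ {x} _ → neg (box a (neg (χ-modal x)))))))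
           (box a (⋁-modal (Allₚ.map⁺ (All.tabulate λ {x} _ → χ-modal x))))

  χ-lits : ∀ {v d} (τ : Ty d) → v ⊩ χ τ → v ⊩ lits (val τ)
  χ-lits {d = zero} _ h = h
  χ-lits {d = suc e} _ h = ∧-elimˡ h

  χ-∇ : ∀ {v e} (τ : Ty (suc e)) → v ⊩ χ τ → ∀ a → v ⊩ ∇ a (map χ (succs τ a))
  χ-∇ _ h = ⋀A-elim (∧-elimʳ h)

  ⊩-lits-agreeing : ∀ v → v ⊩ lits (agreeing (v ∘ atom))
  ⊩-lits-agreeing v = ⊩-lits⁺ (agreeing (v ∘ atom)) (agreeing-agrees (v ∘ atom))

  ⊢-cover : ∀ d → ⊢ ⋁ (map χ (allTy d))
  ⊢-cover zero = taut λ v →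
    ⋁-intro (Anyₚ.map⁺ (lose (∈-allValuations (agreeing (v ∘ atom))) (⊩-lits-agreeing v)))
  ⊢-cover (suc e) =
    taut-All (Allₚ.map⁺ (All.tabulate {xs = allFin (suc k)} λ {a} _ → ∇-cover a χ (allTy e) (⊢-cover e)))
      λ {v} hs →
        let pick : ∀ a → ∃ λ ys → ys ∈ sublists (allTy e) × v ⊩ ∇ a (map χ ys)
            pick a = find (Anyₚ.map⁻ (⋁-elim (All.lookup (Allₚ.map⁻ hs) (∈-allFin a))))
            Ψ = Vec.tabulate (proj₁ ∘ pick)
            Ψ-lookup : ∀ a → proj₁ (pick a) ≡ Vec.lookup Ψ a
            Ψ-lookup a = sym (Vecₚ.lookup∘tabulate (proj₁ ∘ pick) a)
            τ∈ = ∈-allTy-suc (agreeing (v ∘ atom)) Ψ λ a →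
                   subst (_∈ sublists (allTy e)) (Ψ-lookup a) (proj₁ (proj₂ (pick a)))
            χτ = ∧-intro (⊩-lits-agreeing v) (⋀A-intro λ a →
                   subst (λ ys → v ⊩ ∇ a (map χ ys)) (Ψ-lookup a) (proj₂ (proj₂ (pick a))))
        in ⋁-intro (Anyₚ.map⁺ (lose τ∈ χτ))

  ⟨⇉⟩-χ : ∀ {e} b (Ψ : Vec (List (Ty e)) (suc k)) →
          ⊢ (⟨⇉⟩ (χ {suc e} (b , Ψ)) ⇔ (lits b ∧f ⋀A (λ a → □ a (⋁ (map ⟨⇉⟩ (map χ (Vec.lookup Ψ a)))))))
  ⟨⇉⟩-χ b Ψ = taut₂ (SQ3 _ (lits-prop b)) (SQ4cons (λ a → map χ (Vec.lookup Ψ a)) characteristic)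
    λ sq3 sq4 → ∧-intro
      (⇒-intro λ h → let h′ = ⇔-elimˡ sq3 h in ∧-intro (∧-elimˡ h′) (⇔-elimˡ sq4 (∧-elimʳ h′)))
      (⇒-intro λ h → ⇔-elimʳ sq3 (∧-intro (∧-elimˡ h) (⇔-elimʳ sq4 (∧-elimʳ h))))
    where
    characteristic : ∀ a {φ} → φ ∈ map χ (Vec.lookup Ψ a) → IsModal φ × Consistent φ
    characteristic a φ∈ with ∈-map⁻ χ φ∈
    ... | x , _ , refl = χ-modal x , χ-consistent x

  χ-≼ : ∀ {d} {τ σ : Ty d} → τ ≼ σ → ⊢ (χ τ ⇒ ⟨⇉⟩ (χ σ))
  χ-≼ {zero} {b} refl = taut₁ (SQ1 (lits-prop b)) λ sq1 → ⇒-intro (⇔-elimʳ sq1)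
  χ-≼ {suc e} {b , Ψ} {.b , Ψ′} (refl , sim) = taut₂ (⟨⇉⟩-χ b Ψ′) (⋀A-mono □-step) λ red mono →
    ⇒-intro λ h → ⇔-elimʳ red (∧-intro (∧-elimˡ h) (⇒-elim mono (∧-elimʳ h)))
    where
    simulated : ∀ a {x} → x ∈ Vec.lookup Ψ a → ⊢ (χ x ⇒ ⋁ (map ⟨⇉⟩ (map χ (Vec.lookup Ψ′ a))))
    simulated a x∈ with find (All.lookup (sim a) x∈)
    ... | y , y∈ , x≼y = taut₁ (χ-≼ x≼y) λ h →
      ⇒-intro λ χx → ⋁-intro (Anyₚ.map⁺ (Anyₚ.map⁺ (lose y∈ (⇒-elim h χx))))
    □-step : ∀ a → ⊢ (∇ a (map χ (Vec.lookup Ψ a)) ⇒ □ a (⋁ (map ⟨⇉⟩ (map χ (Vec.lookup Ψ′ a)))))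
    □-step a = taut₁ (□-mono a (⋁-cases (Vec.lookup Ψ a) (simulated a))) λ h →
      ⇒-intro λ ∇a → ⇒-elim h (∧-elimʳ ∇a)

  ⋠-reason : ∀ {e} {τ σ : Ty (suc e)} → ¬ τ ≼ σ →
             ¬ val τ ≡ val σ ⊎ ∃ λ a → ∃ λ x → x ∈ succs τ a × All (λ y → ¬ x ≼ y) (succs σ a)
  ⋠-reason {τ = τ} {σ} τ⋠σ with Vecₚ.≡-dec Bool._≟_ (val τ) (val σ)
  ... | no val≢ = inj₁ val≢
  ... | yes val≡ with Finₚ.¬∀⟶∃¬ (suc k) _
                       (λ a → All.all? (λ x → Any.any? (x ≼?_) (succs σ a)) (succs τ a))
                       (λ sim → τ⋠σ (val≡ , sim))
  ...   | a , ¬sim with find (Allₚ.¬All⇒Any¬ (λ x → Any.any? (x ≼?_) (succs σ a)) _ ¬sim)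
  ...     | x , x∈ , ¬matched = inj₂ (a , x , x∈ , Allₚ.¬Any⇒All¬ _ ¬matched)

  χ-⋠ : ∀ {d} {τ σ : Ty d} → ¬ τ ≼ σ → ⊢ (χ τ ⇒ (~ ⟨⇉⟩ (χ σ)))
  χ-⋠ {zero} {b} {b′} b≢b′ = taut₁ (SQ1 (lits-prop b′)) λ sq1 →
    ⇒-intro λ h → ~-intro λ h′ → b≢b′ (lits-unique b b′ h (⇔-elimˡ sq1 h′))
  χ-⋠ {suc e} {τ@(b , Ψ)} {σ@(b′ , Ψ′)} τ⋠σ with ⋠-reason {τ = τ} {σ} τ⋠σ
  ... | inj₁ b≢b′ = taut₁ (⟨⇉⟩-χ b′ Ψ′) λ red →
    ⇒-intro λ h → ~-intro λ h′ → b≢b′ (lits-unique b b′ (∧-elimˡ h) (∧-elimˡ (⇔-elimˡ red h′)))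
  ... | inj₂ (a , x , x∈ , x⋠) = taut₂ (⟨⇉⟩-χ b′ Ψ′) (□-mono a excluded) λ red □⋁⇒□¬χx →
    ⇒-intro λ h → ~-intro λ h′ →
      ~-elim (∇-◇ (χ-∇ τ h a) x∈) (⇒-elim □⋁⇒□¬χx (⋀A-elim (∧-elimʳ (⇔-elimˡ red h′)) a))
    where
    excluded : ⊢ (⋁ (map ⟨⇉⟩ (map χ (succs σ a))) ⇒ (~ χ x))
    excluded = ⋁-map-cases ⟨⇉⟩ χ (succs σ a) λ y∈ → taut₁ (χ-⋠ (All.lookup x⋠ y∈)) λ h →
      ⇒-intro λ ◇y → ~-intro λ χx → ~-elim (⇒-elim h χx) ◇y

  Admissible : ℕ → Form → Set
  Admissible d (atom p) = p ∈ As
  Admissible d (~ φ) = Admissible d φ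
  Admissible d (φ ∧f ψ) = Admissible d φ × Admissible d ψ
  Admissible zero (□ a φ) = ⊥
  Admissible (suc e) (□ a φ) = Admissible e φ
  Admissible d ([⇉] φ) = Admissible d φ

  admissible : ∀ φ {d} → (∀ {p} → p ∈ atoms φ → p ∈ As) → modalDepth φ ≤ d → Admissible d φ
  admissible (atom p) atoms⊆ _ = atoms⊆ (here refl)
  admissible (~ φ) atoms⊆ depth≤ = admissible φ atoms⊆ depth≤
  admissible (φ ∧f ψ) atoms⊆ depth≤ =
    admissible φ (atoms⊆ ∘ ∈-++⁺ˡ) (ℕₚ.m⊔n≤o⇒m≤o (modalDepth φ) (modalDepth ψ) depth≤) ,
    admissible ψ (atoms⊆ ∘ ∈-++⁺ʳ (atoms φ)) (ℕₚ.m⊔n≤o⇒n≤o (modalDepth φ) (modalDepth ψ) depth≤)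
  admissible (□ a φ) {suc e} atoms⊆ (s≤s depth≤) = admissible φ atoms⊆ depth≤
  admissible ([⇉] φ) atoms⊆ depth≤ = admissible φ atoms⊆ depth≤

  record Decides {d} (τ : Ty d) (φ : Form) : Set where
    field
      proves : Sat τ φ → ⊢ (χ τ ⇒ φ)
      refutes : ¬ Sat τ φ → ⊢ (χ τ ⇒ (~ φ))
  open Decides

  □-decides : ∀ {e} {φ} → (∀ (x : Ty e) → Decides x φ) → ∀ a (τ : Ty (suc e)) → Decides τ (□ a φ)
  □-decides {φ = φ} decides a τ .proves all =
    taut₁ (□-mono a (⋁-cases (succs τ a) λ x∈ → decides _ .proves (All.lookup all x∈))) λ h →
      ⇒-intro λ χτ → ⇒-elim h (∧-elimʳ (χ-∇ τ χτ a))
  □-decides {φ = φ} decides a τ .refutes ¬all with find (Allₚ.¬All⇒Any¬ (λ x → Sat? x φ) _ ¬all)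
  ... | x , x∈ , ¬φx = taut₁ (□-mono a (taut₁ (decides x .refutes ¬φx) contrapositive)) λ h →
    ⇒-intro λ χτ → ~-intro λ □φ → ~-elim (∇-◇ (χ-∇ τ χτ a) x∈) (⇒-elim h □φ)
    where
    contrapositive : ∀ {v} → v ⊩ (χ x ⇒ (~ φ)) → v ⊩ (φ ⇒ (~ χ x))
    contrapositive h = ⇒-intro λ φ′ → ~-intro λ χx → ~-elim (⇒-elim h χx) φ′

  [⇉]-decides : ∀ {d} {φ} → (∀ (σ : Ty d) → Decides σ φ) → ∀ (τ : Ty d) → Decides τ ([⇉] φ)
  [⇉]-decides {d} {φ} decides τ .proves all =
    taut₂ (⊢⇒-trans (⟨⇉⟩-mono refuted-by-failures) (⊢⇒-trans (⟨⇉⟩-⋁ (map χ failures)) failures-excluded))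
          ([⇉]-dual φ) λ h dual →
      ⇒-intro λ χτ → ⇔-elimʳ dual (~-intro λ ◇¬φ → ~-elim (⇒-elim h ◇¬φ) χτ)
    where
    fails? : ∀ σ → Dec (¬ Sat σ φ)
    fails? σ = ¬? (Sat? σ φ)
    failures : List (Ty d)
    failures = filter fails? (allTy d)
    refuted-by-failures : ⊢ ((~ φ) ⇒ ⋁ (map χ failures))
    refuted-by-failures = MP (⊢-cover d) (⋁-cases (allTy d) case)
      where
      case : ∀ {σ} → σ ∈ allTy d → ⊢ (χ σ ⇒ ((~ φ) ⇒ ⋁ (map χ failures)))
      case {σ} σ∈ with Sat? σ φ
      ... | yes φσ = taut₁ (decides σ .proves φσ) λ h →
        ⇒-intro λ χσ → ⇒-intro λ ¬φ → ⊥-elim (~-elim ¬φ (⇒-elim h χσ))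
      ... | no ¬φσ = taut λ _ →
        ⇒-intro λ χσ → ⇒-intro λ _ → ⋁-intro (Anyₚ.map⁺ (lose (∈-filter⁺ fails? σ∈ ¬φσ) χσ))
    failures-excluded : ⊢ (⋁ (map ⟨⇉⟩ (map χ failures)) ⇒ (~ χ τ))
    failures-excluded = ⋁-map-cases ⟨⇉⟩ χ failures λ σ∈ →
      let (σ∈all , ¬φσ) = ∈-filter⁻ fails? σ∈
      in taut₁ (χ-⋠ λ τ≼σ → ¬φσ (All.lookup all σ∈all τ≼σ)) λ h →
           ⇒-intro λ ◇σ → ~-intro λ χτ → ~-elim (⇒-elim h χτ) ◇σ
  [⇉]-decides {d} {φ} decides τ .refutes ¬all
    with find (Allₚ.¬All⇒Any¬ (λ σ → (τ ≼? σ) →-dec Sat? σ φ) _ ¬all)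
  ... | σ , _ , ¬[τ≼σ⇒φσ] =
    taut₂ (⊢⇒-trans (χ-≼ τ≼σ) (⟨⇉⟩-mono (decides σ .refutes ¬φσ))) ([⇉]-dual φ) λ h dual →
      ⇒-intro λ χτ → ~-intro λ □φ → ~-elim (⇔-elimˡ dual □φ) (⇒-elim h χτ)
    where
    τ≼σ : τ ≼ σ
    τ≼σ = decidable-stable (τ ≼? σ) λ τ⋠σ → ¬[τ≼σ⇒φσ] (⊥-elim ∘ τ⋠σ)
    ¬φσ : ¬ Sat σ φ
    ¬φσ φσ = ¬[τ≼σ⇒φσ] λ _ → φσ

  χ-decides : ∀ {d} φ → Admissible d φ → (τ : Ty d) → Decides τ φ
  χ-decides (atom p) p∈ τ = record
    { proves = λ φτ → taut λ _ → ⇒-intro λ χτ → mk⊩ (trans (agrees χτ) φτ)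
    ; refutes = λ ¬φτ → taut λ _ →
        ⇒-intro λ χτ → ~-intro λ { (mk⊩ p′) → ¬φτ (trans (sym (agrees χτ)) p′) }
    }
    where
    agrees : ∀ {v} → v ⊩ χ τ → v (atom p) ≡ valuationOf (val τ) p
    agrees {v} χτ = agrees-valuationOf (v ∘ atom) (val τ) (⊩-lits⁻ (val τ) (χ-lits τ χτ)) p∈
  χ-decides (~ φ) ok τ = record
    { proves = refutes IH
    ; refutes = λ ¬¬φτ → taut₁ (IH .proves (Sat-stable τ φ ¬¬φτ)) λ h →
        ⇒-intro λ χτ → ~-intro λ ¬φ → ~-elim ¬φ (⇒-elim h χτ)
    }
    where IH = χ-decides φ ok τ
  χ-decides (φ ∧f ψ) (ok₁ , ok₂) τ = record
    { proves = λ (φτ , ψτ) → taut₂ (IHφ .proves φτ) (IHψ .proves ψτ) λ h₁ h₂ →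
        ⇒-intro λ χτ → ∧-intro (⇒-elim h₁ χτ) (⇒-elim h₂ χτ)
    ; refutes = λ ¬φψτ → case Sat? τ φ of λ where
        (no ¬φτ) → taut₁ (IHφ .refutes ¬φτ) λ h →
          ⇒-intro λ χτ → ~-intro λ φψ → ~-elim (⇒-elim h χτ) (∧-elimˡ φψ)
        (yes φτ) → taut₁ (IHψ .refutes (λ ψτ → ¬φψτ (φτ , ψτ))) λ h →
          ⇒-intro λ χτ → ~-intro λ φψ → ~-elim (⇒-elim h χτ) (∧-elimʳ φψ)
    }
    where
    IHφ = χ-decides φ ok₁ τ
    IHψ = χ-decides ψ ok₂ τ
  χ-decides {suc e} (□ a φ) ok τ = □-decides (χ-decides φ ok) a τ
  χ-decides ([⇉] φ) ok τ = [⇉]-decides (χ-decides φ ok) τ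

module Completeness (AT : Atoms) (k : ℕ) (As : List (Atoms.Atom AT)) (As-unique : Unique As) where

  open Atoms AT
  open Logic AT k
  open Model
  open SMLReasoning AT k
  open CharacteristicFormulas AT k As As-unique
  open Decides
  open Lists
  open Encodings
  open RawMonad (¬¬-Monad {0ℓ})

  mutual
    -- Successor conditions hold only up to double negation: that is all a
    -- constructive reading of an arbitrary model can provide (see realizes-some).
    Realizes : (M : Model) → S M → ∀ {d} → Ty d → Set
    Realizes M s {zero} b = Agrees (V M s) b
    Realizes M s {suc e} τ = Agrees (V M s) (val τ) × (∀ a → SuccessorTypes M s a (succs τ a))

    SuccessorTypes : (M : Model) → S M → Agent → ∀ {e} → List (Ty e) → Set
    SuccessorTypes M s a xs =
      (∀ {u} → R M a s u → ¬ ¬ Any (Realizes M u) xs) ×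
      All (λ x → ¬ ¬ ∃ λ u → R M a s u × Realizes M u x) xs

  realizes-agrees : ∀ {M s d} (τ : Ty d) → Realizes M s τ → Agrees (V M s) (val τ)
  realizes-agrees {d = zero} _ sτ = sτ
  realizes-agrees {d = suc e} _ sτ = proj₁ sτ

  realizes-tabulate : ∀ {M s e} b (Ψ : Agent → List (Ty e)) →
                      Agrees (V M s) b → (∀ a → SuccessorTypes M s a (Ψ a)) →
                      Realizes M s {suc e} (b , Vec.tabulate Ψ)
  realizes-tabulate {M} {s} b Ψ agrees succ =
    agrees , λ a → subst (SuccessorTypes M s a) (sym (Vecₚ.lookup∘tabulate Ψ a)) (succ a)

  realizes-some : ∀ M s d → ¬ ¬ ∃ λ (τ : Ty d) → τ ∈ allTy d × Realizes M s τ
  realizes-some M s zero =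
    pure (agreeing (V M s) , ∈-allValuations (agreeing (V M s)) , agreeing-agrees (V M s))
  -- Decide (under ¬¬) which candidate types are realized by some a-successor, and keep those.
  realizes-some M s (suc e) = do
    decided ← Finₚ.sequence rawApplicative λ a →
      All.sequenceA 0ℓ rawApplicative (All.tabulate {xs = allTy e} λ _ → ¬¬-excluded-middle)
    let Ψ a = proj₁ (partitionBy (allTy e) (decided a))
    pure ( (agreeing (V M s) , Vec.tabulate Ψ)
         , ∈-allTy-suc _ _ (λ a → subst (_∈ sublists (allTy e)) (sym (Vecₚ.lookup∘tabulate Ψ a))
                                        (∈-map⁺ proj₁ (partitionBy-∈-splits _ (decided a))))
         , realizes-tabulate (agreeing (V M s)) Ψ (agreeing-agrees (V M s)) λ a →
             (λ {u} r → do
                (x , x∈ , ux) ← realizes-some M u e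
                pure (lose (∈-partitionBy⁺ (decided a) x∈ (u , r , ux)) ux))
           , All.map pure (partitionBy-accepted (allTy e) (decided a)))

  realizes-back : ∀ {M s e} (τ : Ty (suc e)) → Realizes M s τ →
                  ∀ a {u} → R M a s u → ¬ ¬ Any (Realizes M u) (succs τ a)
  realizes-back _ sτ a = proj₁ (proj₂ sτ a)

  realizes-forth : ∀ {M s e} (τ : Ty (suc e)) → Realizes M s τ →
                   ∀ a {x} → x ∈ succs τ a → ¬ ¬ ∃ λ u → R M a s u × Realizes M u x
  realizes-forth _ sτ a = All.lookup (proj₂ (proj₂ sτ a))

  simulation-≼ : ∀ {M M′ Z} → IsSimulation M M′ Z → ∀ {d s t} {τ σ : Ty d} →
                 Z s t → Realizes M s τ → Realizes M′ t σ → τ ≼ σ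
  simulation-≼ {M} sim {zero} {s} {t} {τ} {σ} z sτ tσ =
    agrees-unique {V M s} τ σ sτ λ i → trans (proj₁ (sim s t z) _) (tσ i)
  simulation-≼ {M} sim {suc e} {s} {t} {τ} {σ} z sτ tσ =
    agrees-unique {V M s} (val τ) (val σ) (realizes-agrees τ sτ)
                  (λ i → trans (proj₁ (sim s t z) _) (realizes-agrees σ tσ i)) ,
    λ a → All.tabulate λ {x} x∈ → decidable-stable (Any.any? (x ≼?_) (succs σ a)) do
      (u , r , ux) ← realizes-forth τ sτ a x∈
      let (u′ , r′ , z′) = proj₂ (sim s t z) a u r
      u′-realizes ← realizes-back σ tσ a r′
      let (y , y∈ , u′y) = find u′-realizes
      pure (lose y∈ (simulation-≼ sim z′ ux u′y))

  identity-simulation : ∀ M → IsSimulation M M _≡_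
  identity-simulation M s .s refl = (λ _ → refl) , λ a t r → t , r , refl

  realizes-≼ : ∀ {M s d} {τ τ′ : Ty d} → Realizes M s τ → Realizes M s τ′ → τ ≼ τ′
  realizes-≼ {M} = simulation-≼ (identity-simulation M) refl

  record IsBoundedMorphism (M M′ : Model) (f : S M → S M′) : Set where
    field
      valuation : ∀ s p → V M′ (f s) p ≡ V M s p
      forth : ∀ {a s t} → R M a s t → R M′ a (f s) (f t)
      back : ∀ {a s w} → R M′ a (f s) w → ∃ λ t → R M a s t × w ≡ f t

  realizes-image : ∀ {M M′ f} → IsBoundedMorphism M M′ f →
                   ∀ {d s} {τ : Ty d} → Realizes M s τ → Realizes M′ (f s) τ
  realizes-image bm {zero} {s} sτ i = trans (IsBoundedMorphism.valuation bm s _) (sτ i)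
  realizes-image {M} {M′} {f} bm {suc e} {s} {τ} sτ =
    (λ i → trans (IsBoundedMorphism.valuation bm s _) (realizes-agrees τ sτ i)) ,
    λ a → back′ a , All.map forth′ (proj₂ (proj₂ sτ a))
    where
    back′ : ∀ a {w} → R M′ a (f s) w → ¬ ¬ Any (Realizes M′ w) (succs τ a)
    back′ a r with IsBoundedMorphism.back bm r
    ... | t , r′ , refl = ¬¬-map (Any.map (realizes-image bm)) (realizes-back τ sτ a r′)
    forth′ : ∀ {a} {x : Ty e} → ¬ ¬ (∃ λ u → R M a s u × Realizes M u x) →
             ¬ ¬ (∃ λ w → R M′ a (f s) w × Realizes M′ w x)
    forth′ = ¬¬-map λ (u , r , ux) → f u , IsBoundedMorphism.forth bm r , realizes-image bm ux

  data TypeStep (a : Agent) : Σ ℕ Ty → Σ ℕ Ty → Set where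
    step : ∀ {e} {τ : Ty (suc e)} {x} → x ∈ succs τ a → TypeStep a (suc e , τ) (e , x)

  ty-countable : ∀ d → Countable (Ty d)
  ty-countable zero = vec-countable bool-countable
  ty-countable (suc e) =
    ×-countable (vec-countable bool-countable) (vec-countable (list-countable (ty-countable e)))

  typeModel : Model
  typeModel = record
    { S = Σ ℕ Ty
    ; stateCode = Injection.to countable
    ; stateCode-injective = Injection.injective countable
    ; R = TypeStep
    ; V = λ (_ , τ) → valuationOf (val τ)
    }
    where
    countable = Σℕ-countable ty-countable

  typeModel-realizes : ∀ {d} (τ : Ty d) → Realizes typeModel (d , τ) τ
  typeModel-realizes {zero} b = valuationOf-agrees b
  typeModel-realizes {suc e} τ = valuationOf-agrees (val τ) , λ a →
    (λ { (step x∈) → pure (lose x∈ (typeModel-realizes _)) }) ,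
    All.tabulate λ {x} x∈ → pure ((e , x) , step x∈ , typeModel-realizes x)

  module Unravelling (M : Model) (n : S M) {d} (τ₀ σ₀ : Ty d)
                     (n⊩τ₀ : Realizes M n τ₀) (τ₀≼σ₀ : τ₀ ≼ σ₀) where

    -- The unravelling of M from n, each path carrying a label type (a successor type of its
    -- parent's label), plus a copy of typeModel; witness edges make a path labelled ρ realize ρ.
    Path : Set
    Path = List (Agent × S M)

    node : Path → S M
    node [] = n
    node ((_ , u) ∷ _) = u

    -- The default x is never used: choosable provides a match.
    choose : ∀ {e} → Ty (suc e) → Agent → Ty e → Ty e
    choose ρ a x = firstOr (x ≼?_) x (succs ρ a)

    data Label : ∀ {e} → Path → Ty e → Set where
      root : Label [] σ₀
      step : ∀ {e π a u} {ρ : Ty (suc e)} {x : Ty e} →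
             Label π ρ → R M a (node π) u → Realizes M u x → Label ((a , u) ∷ π) (choose ρ a x)

    mutual
      label-sound : ∀ {e π} {ρ : Ty e} → Label π ρ → ∃ λ τ → Realizes M (node π) τ × τ ≼ ρ
      label-sound root = τ₀ , n⊩τ₀ , τ₀≼σ₀
      label-sound (step l r ux) = _ , ux , proj₂ (firstOr-satisfies _ (choosable l r ux))

      choosable : ∀ {e π a u} {ρ : Ty (suc e)} {x : Ty e} →
                  Label π ρ → R M a (node π) u → Realizes M u x → Any (x ≼_) (succs ρ a)
      choosable {a = a} {ρ = ρ} {x} l r ux with label-sound l
      ... | τ , πτ , τ≼ρ = decidable-stable (Any.any? (x ≼?_) (succs ρ a)) do
        u-realizes ← realizes-back τ πτ a r
        let (x′ , x′∈ , ux′) = find u-realizes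
        let (y , y∈ , x′≼y) = find (All.lookup (proj₂ τ≼ρ a) x′∈)
        pure (lose y∈ (≼-trans (realizes-≼ ux ux′) x′≼y))

    -- Types realized at the same state are ≼-equivalent, so they lead to the same choice.
    label-functional : ∀ {e e′ π} {ρ : Ty e} {ρ′ : Ty e′} →
                       Label π ρ → Label π ρ′ → _≡_ {A = Σ ℕ Ty} (e , ρ) (e′ , ρ′)
    label-functional root root = refl
    label-functional (step {e} l r ux) (step l′ r′ ux′) with label-functional l l′
    ... | refl = cong (e ,_) (firstOr-cong _ _ (λ _ → ≼-trans (realizes-≼ ux′ ux))
                                               (λ _ → ≼-trans (realizes-≼ ux ux′)) (choosable l r ux))

    data Step (a : Agent) : Path ⊎ Σ ℕ Ty → Path ⊎ Σ ℕ Ty → Set where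
      along : ∀ {π u} → R M a (node π) u → Step a (inj₁ π) (inj₁ ((a , u) ∷ π))
      witness : ∀ {e π} {ρ : Ty (suc e)} {x} → Label π ρ → x ∈ succs ρ a → Step a (inj₁ π) (inj₂ (e , x))
      inside : ∀ {c c′} → TypeStep a c c′ → Step a (inj₂ c) (inj₂ c′)

    unravelled : Model
    unravelled = record
      { S = Path ⊎ Σ ℕ Ty
      ; stateCode = Injection.to countable
      ; stateCode-injective = Injection.injective countable
      ; R = Step
      ; V = λ { (inj₁ π) → V M (node π) ; (inj₂ c) → V typeModel c }
      }
      where
      countable = ⊎-countable (list-countable (×-countable fin-countable (mk↣ (stateCode-injective M))))
                              (Σℕ-countable ty-countable)

    typeModel-embedded : IsBoundedMorphism typeModel unravelled inj₂
    typeModel-embedded = record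
      { valuation = λ _ _ → refl
      ; forth = inside
      ; back = λ { (inside st) → _ , st , refl }
      }

    label-realizes : ∀ {e π} {ρ : Ty e} → Label π ρ → Realizes unravelled (inj₁ π) ρ
    label-realizes {zero} l with label-sound l
    ... | τ , πτ , refl = πτ
    label-realizes {suc e} {π} {ρ} l with label-sound l
    ... | τ , πτ , τ≼ρ =
      subst (Agrees (V M (node π))) (≼-val {τ = τ} {ρ} τ≼ρ) (realizes-agrees τ πτ) , λ a → back a , forth a
      where
      back : ∀ a {w} → Step a (inj₁ π) w → ¬ ¬ Any (Realizes unravelled w) (succs ρ a)
      back a (along {u = u} r) = do
        (x , _ , ux) ← realizes-some M u e
        pure (lose (proj₁ (firstOr-satisfies _ (choosable l r ux))) (label-realizes (step l r ux)))
      back a (witness l′ x∈) with label-functional l′ l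
      ... | refl = pure (lose x∈ (realizes-image typeModel-embedded (typeModel-realizes _)))
      forth : ∀ a → All (λ x → ¬ ¬ ∃ λ w → Step a (inj₁ π) w × Realizes unravelled w x) (succs ρ a)
      forth a = All.tabulate λ {x} x∈ →
        pure (inj₂ (e , x) , witness l x∈ , realizes-image typeModel-embedded (typeModel-realizes x))

    unravel : Simulates M n unravelled (inj₁ []) × Realizes unravelled (inj₁ []) σ₀
    unravel = (Z , simulation , refl) , label-realizes root
      where
      Z : S M → Path ⊎ Σ ℕ Ty → Set
      Z s (inj₁ π) = node π ≡ s
      Z s (inj₂ _) = ⊥
      simulation : IsSimulation M unravelled Z
      simulation s (inj₁ π) refl = (λ _ → refl) , λ a t r → inj₁ ((a , t) ∷ π) , along r , refl

  ⊨-stable : ∀ M s φ → ¬ ¬ (M , s ⊨ φ) → M , s ⊨ φ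
  ⊨-stable M s (atom p) ¬¬p = lift (decidable-stable (V M s p Bool.≟ true) λ ¬p → ¬¬p (¬p ∘ lower))
  ⊨-stable M s (~ φ) ¬¬¬φ φ′ = ¬¬¬φ λ ¬φ → ¬φ φ′
  ⊨-stable M s (φ ∧f ψ) ¬¬φψ =
    ⊨-stable M s φ (λ ¬φ → ¬¬φψ (¬φ ∘ proj₁)) , ⊨-stable M s ψ (λ ¬ψ → ¬¬φψ (¬ψ ∘ proj₂))
  ⊨-stable M s (□ a φ) ¬¬□φ t r = ⊨-stable M t φ λ ¬φ → ¬¬□φ λ □φ → ¬φ (□φ t r)
  ⊨-stable M s ([⇉] φ) ¬¬[⇉]φ M′ s′ sim =
    ⊨-stable M′ s′ φ λ ¬φ → ¬¬[⇉]φ λ [⇉]φ → ¬φ ([⇉]φ M′ s′ sim)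

  record Truth (M : Model) (s : S M) {d} (τ : Ty d) (φ : Form) : Set₁ where
    field
      ⊨⇒Sat : M , s ⊨ φ → Sat τ φ
      Sat⇒⊨ : Sat τ φ → M , s ⊨ φ
  open Truth

  □-truth : ∀ {e φ} → (∀ M s (x : Ty e) → Realizes M s x → Truth M s x φ) →
            ∀ a M s (τ : Ty (suc e)) → Realizes M s τ → Truth M s τ (□ a φ)
  □-truth {φ = φ} truth a M s τ sτ .⊨⇒Sat □φ = All.tabulate λ {x} x∈ → Sat-stable x φ do
    (u , r , ux) ← realizes-forth τ sτ a x∈
    pure (truth M u x ux .⊨⇒Sat (□φ u r))
  □-truth {φ = φ} truth a M s τ sτ .Sat⇒⊨ all u r =
    ⊨-stable M u φ λ ¬φ → realizes-back τ sτ a r λ u-realizes →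
      let (x , x∈ , ux) = find u-realizes in ¬φ (truth M u x ux .Sat⇒⊨ (All.lookup all x∈))

  [⇉]-truth : ∀ {d φ} → (∀ M s (σ : Ty d) → Realizes M s σ → Truth M s σ φ) →
              ∀ M s (τ : Ty d) → Realizes M s τ → Truth M s τ ([⇉] φ)
  [⇉]-truth truth M s τ sτ .⊨⇒Sat [⇉]φ = All.tabulate λ {σ} _ τ≼σ →
    let open Unravelling M s τ σ sτ τ≼σ
        (simulates , σ-realized) = unravel
    in truth unravelled (inj₁ []) σ σ-realized .⊨⇒Sat ([⇉]φ unravelled (inj₁ []) simulates)
  [⇉]-truth {d} {φ} truth M s τ sτ .Sat⇒⊨ all M′ s′ (Z , simulation , z) = ⊨-stable M′ s′ φ λ ¬φ →
    realizes-some M′ s′ d λ (σ , σ∈ , s′σ) →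
      ¬φ (truth M′ s′ σ s′σ .Sat⇒⊨ (All.lookup all σ∈ (simulation-≼ simulation z sτ s′σ)))

  truth-lemma : ∀ {d} φ → Admissible d φ → ∀ M s (τ : Ty d) → Realizes M s τ → Truth M s τ φ
  truth-lemma (atom p) p∈ M s τ sτ = record
    { ⊨⇒Sat = λ p′ → trans (sym agrees) (lower p′)
    ; Sat⇒⊨ = λ p′ → lift (trans agrees p′)
    }
    where
    agrees : V M s p ≡ valuationOf (val τ) p
    agrees = agrees-valuationOf (V M s) (val τ) (realizes-agrees τ sτ) p∈
  truth-lemma (~ φ) ok M s τ sτ = record
    { ⊨⇒Sat = λ ¬φ φτ → ¬φ (IH .Sat⇒⊨ φτ)
    ; Sat⇒⊨ = λ ¬φτ φ′ → ¬φτ (IH .⊨⇒Sat φ′)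
    }
    where IH = truth-lemma φ ok M s τ sτ
  truth-lemma (φ ∧f ψ) (ok₁ , ok₂) M s τ sτ = record
    { ⊨⇒Sat = λ (φ′ , ψ′) → IHφ .⊨⇒Sat φ′ , IHψ .⊨⇒Sat ψ′
    ; Sat⇒⊨ = λ (φτ , ψτ) → IHφ .Sat⇒⊨ φτ , IHψ .Sat⇒⊨ ψτ
    }
    where
    IHφ = truth-lemma φ ok₁ M s τ sτ
    IHψ = truth-lemma ψ ok₂ M s τ sτ
  truth-lemma {suc e} (□ a φ) ok = □-truth (λ M s x → truth-lemma φ ok M s x) a
  truth-lemma ([⇉] φ) ok = [⇉]-truth (λ M s σ → truth-lemma φ ok M s σ)

  complete : ∀ φ → (∀ {p} → p ∈ atoms φ → p ∈ As) → Valid φ → ⊢ φ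
  complete φ atoms⊆ valid = MP (⊢-cover d) (⋁-cases (allTy d) λ {τ} _ → χ-decides φ ok τ .proves (sat τ))
    where
    d = modalDepth φ
    ok = admissible φ atoms⊆ ℕₚ.≤-refl
    sat : (τ : Ty d) → Sat τ φ
    sat τ = truth-lemma φ ok typeModel (d , τ) τ (typeModel-realizes τ) .⊨⇒Sat (valid typeModel (d , τ))

proposition10 : (AT : Atoms) (k : ℕ) (φ : Logic.Form AT k) →
                Logic.Valid AT k φ → Logic.⊢_ AT k φ
proposition10 AT k φ = complete φ (∈-deduplicate⁺ _≟atom_)
  where
  open Logic AT k using (_≟atom_)
  open SMLReasoning AT k using (atoms)
  open Completeness AT k (deduplicate _≟atom_ (atoms φ)) (UniqueDecₚ.deduplicate-! _≟atom_ (atoms φ))
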